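{- Let $G$ be a graph and $u$ a vertex of $G$. If there exist a set $T_0\in\mathcal{T}_0^u$ and a set $F\subseteq V(G)$ with $|F|\leq 4$ such that $t(G,\,T_0\cup N_{\geq 3}(u)\cup F,\,u)=3$, then for every set $T_0'\in\mathcal{T}_0^u$ there is a set $F'\subseteq V(G)$ with $|F'|\leq 4$ such that $t(G,\,T_0'\cup N_{\geq 3}(u)\cup F',\,u)=3$.
   Context: All graphs are finite and simple. In 2-neighbor bootstrap percolation on $G$, given $S\subseteq V(G)$ one sets $S_{(0)}=S$ and $S_{(i+1)}=S_{(i)}\cup\{v: v \text{ has at least two neighbors in } S_{(i)}\}$. $t(G,S,v)$ is the minimum $t$ with $v\in S_{(t)}$ ($\infty$ if none). $N_{\geq i}(u)$ is the set of vertices at distance at least $i$ from $u$. A separator is a vertex whose removal disconnects $G$. For a vertex $u$, $\mathcal{T}_0^u$ is the family of sets $T_0\subseteq V(G)$ such that: for every separator $v$ and every connected component $H$ of $G-v$ with $u\notin V(H)$ and $V(H)\subseteq N(v)$, $T_0$ contains exactly one vertex of $H$; and every vertex of $T_0$ lies in such a component $H$ (for some separator $v$). -}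

module Defs where

open import Level using (0ℓ)
open import Data.Nat using (ℕ; zero; suc; _<_; _≤_)
open import Data.Fin using (Fin)
open import Data.Fin.Subset using (Subset; _∈_; ∣_∣)
open import Data.Product using (Σ; ∃; ∃-syntax; _×_; _,_)
open import Data.Sum using (_⊎_)
open import Data.Empty using (⊥)
open import Relation.Nullary using (¬_)
open import Relation.Binary.PropositionalEquality using (_≡_; _≢_)

record Graph : Set₁ where
  field
    n      : ℕ
    Adj    : Fin n → Fin n → Set
    sym    : ∀ {x y} → Adj x y → Adj y x
    irrefl : ∀ {x} → ¬ Adj x x

open Graph public

V : Graph → Set
V G = Fin (n G)

VPred : Graph → Set₁
VPred G = V G → Set

Perc : (G : Graph) → VPred G → ℕ → VPred G
Perc G S zero    v = S v
Perc G S (suc i) v =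
  Perc G S i v ⊎
  (Σ (V G) λ w₁ → Σ (V G) λ w₂ →
     w₁ ≢ w₂ × Adj G v w₁ × Adj G v w₂ × Perc G S i w₁ × Perc G S i w₂)

PercTime≡ : (G : Graph) → VPred G → V G → ℕ → Set
PercTime≡ G S v t = Perc G S t v × (∀ s → s < t → ¬ Perc G S s v)

data Walk (G : Graph) : ℕ → V G → V G → Set where
  nil  : ∀ {x} → Walk G 0 x x
  cons : ∀ {ℓ x y z} → Adj G x y → Walk G ℓ y z → Walk G (suc ℓ) x z

-- N_{≥ i}(u): vertices at distance at least i from u (including unreachable ones),
-- i.e. no walk of length < i from u.
N≥ : (G : Graph) → ℕ → V G → VPred G
N≥ G i u v = ∀ ℓ → ℓ < i → ¬ Walk G ℓ u v

-- Reachability inside G - v, starting from x (x ≠ v is required separately).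
data ReachAvoid (G : Graph) (v : V G) (x : V G) : V G → Set where
  here : ReachAvoid G v x x
  step : ∀ {y z} → ReachAvoid G v x y → Adj G y z → z ≢ v → ReachAvoid G v x z

InComp : (G : Graph) → (v x : V G) → VPred G
InComp G v x y = x ≢ v × y ≢ v × ReachAvoid G v x y

Separator : (G : Graph) → V G → Set
Separator G v = Σ (V G) λ x → Σ (V G) λ y → x ≢ v × y ≢ v × ¬ ReachAvoid G v x y

GoodComp : (G : Graph) → V G → (v x : V G) → Set
GoodComp G u v x = x ≢ v × ¬ InComp G v x u × (∀ y → InComp G v x y → Adj G v y)

InT0 : (G : Graph) → V G → Subset (n G) → Set
InT0 G u T₀ =
  (∀ v x → Separator G v → GoodComp G u v x →
     Σ (V G) λ y → y ∈ T₀ × InComp G v x y ×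
       (∀ z → z ∈ T₀ → InComp G v x z → z ≡ y))
  × (∀ y → y ∈ T₀ →
     Σ (V G) λ v → Σ (V G) λ x → Separator G v × GoodComp G u v x × InComp G v x y)

StartSet : (G : Graph) → V G → Subset (n G) → Subset (n G) → VPred G
StartSet G u T₀ F w = w ∈ T₀ ⊎ N≥ G 3 u w ⊎ w ∈ F

Good : (G : Graph) → V G → Subset (n G) → Set
Good G u T₀ = Σ (Subset (n G)) λ F → ∣ F ∣ ≤ 4 × PercTime≡ G (StartSet G u T₀ F) u 3

module Submission where

-- Call the component H of G - v containing x *pendant* (for u) if v is a
-- separator, u ∉ H and H ⊆ N(v); a set in 𝒯₀^u picks one *representative* in each
-- pendant component.  H meets the rest of G only through v, so for the infection
-- of u it matters only whether two vertices of H get infected.  Given F, let F′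
-- replace each T₀′-vertex of F by the T₀-representative of its pendant component
-- and drop the T₀-vertices of F.  Then |F′| ≤ |F|, and S = T₀ ∪ N≥3(u) ∪ F and
-- S′ = T₀′ ∪ N≥3(u) ∪ F′ infect u in exactly the same rounds.
--
-- The core is a
-- simulation lemma: if each S₁-vertex is in S₂ or pendant, each pendant component
-- meets S₂, and two S₁-vertices in one force two S₂-vertices there, then every
-- round infecting u from S₁ infects it from S₂.  Checking this for (S, S′) and for
-- (S′, S) gives lemma8.

open import Defs
open import Data.Fin.Subset using (Subset)
open import Data.Product using (Σ; _×_)

open import Data.Product using (_,_; proj₁; proj₂)
open import Data.Sum using (_⊎_; inj₁; inj₂; map₁)
open import Data.Empty using (⊥; ⊥-elim)
open import Data.Maybe using (Maybe; just; nothing)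
open import Data.Nat using (ℕ; zero; suc; _<_; _≤_; s≤s; z≤n)
open import Data.Nat.Properties using (≤-trans; ≤-refl; ≤-reflexive; n≤1+n; <-trans)
open import Data.Nat.Induction using (<-wellFounded)
open import Induction.WellFounded using (Acc; acc)
open import Data.Fin using (Fin; zero; suc; _≟_)
open import Data.Fin.Subset using (_∈_; _∉_; ∣_∣; inside; outside) renaming (⊥ to ∅)
open import Data.Fin.Subset.Properties using (_∈?_; ∉⊥; ∣⊥∣≡0)
open import Data.Vec.Base using (_∷_; []; here; there)
open import Relation.Nullary using (yes; no; ¬_)
open import Relation.Binary.PropositionalEquality
  using (_≡_; _≢_; refl; subst; trans) renaming (sym to ≡-sym)
open import Function using (_∘_)

insert : ∀ {k} → Fin k → Subset k → Subset k
insert zero    (_ ∷ p) = inside ∷ p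
insert (suc j) (b ∷ p) = b ∷ insert j p

∣insert∣≤ : ∀ {k} (j : Fin k) (p : Subset k) → ∣ insert j p ∣ ≤ suc ∣ p ∣
∣insert∣≤ zero    (outside ∷ p) = ≤-refl
∣insert∣≤ zero    (inside ∷ p)  = n≤1+n _
∣insert∣≤ (suc j) (outside ∷ p) = ∣insert∣≤ j p
∣insert∣≤ (suc j) (inside ∷ p)  = s≤s (∣insert∣≤ j p)

∈-insert⁻ : ∀ {k} {w : Fin k} j p → w ∈ insert j p → w ≡ j ⊎ w ∈ p
∈-insert⁻ zero    (_ ∷ p) here      = inj₁ refl
∈-insert⁻ zero    (_ ∷ p) (there q) = inj₂ (there q)
∈-insert⁻ (suc j) (_ ∷ p) here      = inj₂ here
∈-insert⁻ (suc j) (_ ∷ p) (there q) with ∈-insert⁻ j p q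
... | inj₁ refl = inj₁ refl
... | inj₂ w∈p  = inj₂ (there w∈p)

∈-insert-new : ∀ {k} (j : Fin k) p → j ∈ insert j p
∈-insert-new zero    (_ ∷ p) = here
∈-insert-new (suc j) (_ ∷ p) = there (∈-insert-new j p)

∈-insert-old : ∀ {k} {w : Fin k} j p → w ∈ p → w ∈ insert j p
∈-insert-old zero    (_ ∷ p) here      = here
∈-insert-old zero    (_ ∷ p) (there q) = there q
∈-insert-old (suc j) (_ ∷ p) here      = here
∈-insert-old (suc j) (_ ∷ p) (there q) = there (∈-insert-old j p q)

image : ∀ {m k} → (Fin m → Maybe (Fin k)) → Subset m → Subset k
image g []            = ∅
image g (outside ∷ F) = image (g ∘ suc) F
image g (inside ∷ F) with g zero
... | nothing = image (g ∘ suc) F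
... | just j  = insert j (image (g ∘ suc) F)

∣image∣≤ : ∀ {m k} (g : Fin m → Maybe (Fin k)) F → ∣ image g F ∣ ≤ ∣ F ∣
∣image∣≤ {k = k} g [] = ≤-reflexive (∣⊥∣≡0 k)
∣image∣≤ g (outside ∷ F) = ∣image∣≤ (g ∘ suc) F
∣image∣≤ g (inside ∷ F) with g zero
... | nothing = ≤-trans (∣image∣≤ (g ∘ suc) F) (n≤1+n _)
... | just j  = ≤-trans (∣insert∣≤ j (image (g ∘ suc) F)) (s≤s (∣image∣≤ (g ∘ suc) F))

∈-image⁻ : ∀ {m k} {w : Fin k} (g : Fin m → Maybe (Fin k)) F → w ∈ image g F →
           Σ (Fin m) λ z → z ∈ F × g z ≡ just w
∈-image⁻ g [] w∈ = ⊥-elim (∉⊥ w∈)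
∈-image⁻ g (outside ∷ F) w∈ with ∈-image⁻ (g ∘ suc) F w∈
... | z , z∈F , gz = suc z , there z∈F , gz
∈-image⁻ g (inside ∷ F) w∈ with g zero in eq
... | nothing with ∈-image⁻ (g ∘ suc) F w∈
...   | z , z∈F , gz = suc z , there z∈F , gz
∈-image⁻ g (inside ∷ F) w∈ | just j with ∈-insert⁻ j _ w∈
...   | inj₁ refl = zero , here , eq
...   | inj₂ w∈′ with ∈-image⁻ (g ∘ suc) F w∈′
...     | z , z∈F , gz = suc z , there z∈F , gz

∈-image⁺ : ∀ {m k} {w : Fin k} (g : Fin m → Maybe (Fin k)) F z → z ∈ F → g z ≡ just w →
           w ∈ image g F
∈-image⁺ g (inside ∷ F) zero here gz rewrite gz = ∈-insert-new _ (image (g ∘ suc) F)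
∈-image⁺ g (outside ∷ F) (suc z) (there z∈F) gz = ∈-image⁺ (g ∘ suc) F z z∈F gz
∈-image⁺ g (inside ∷ F) (suc z) (there z∈F) gz with g zero
... | nothing = ∈-image⁺ (g ∘ suc) F z z∈F gz
... | just j  = ∈-insert-old j _ (∈-image⁺ (g ∘ suc) F z z∈F gz)

avoid-one : ∀ {k} {P : Fin k → Set} {a b : Fin k} → a ≢ b → P a → P b →
            (y : Fin k) → Σ (Fin k) λ c → P c × c ≢ y
avoid-one {a = a} a≢b pa pb y with a ≟ y
... | yes refl = _ , pb , λ b≡a → a≢b (≡-sym b≡a)
... | no a≢y   = a , pa , a≢y

module Connectivity (G : Graph) where

  snoc : ∀ {ℓ a b c} → Walk G ℓ a b → Adj G b c → Walk G (suc ℓ) a c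
  snoc nil        e′ = cons e′ nil
  snoc (cons e w) e′ = cons e (snoc w e′)

  avoid-end : ∀ {v a b} → ReachAvoid G v a b → a ≢ v → b ≢ v
  avoid-end here           a≢v = a≢v
  avoid-end (step _ _ b≢v) _   = b≢v

  avoid-trans : ∀ {v a b c} → ReachAvoid G v a b → ReachAvoid G v b c → ReachAvoid G v a c
  avoid-trans r here             = r
  avoid-trans r (step r′ e c≢v) = step (avoid-trans r r′) e c≢v

  avoid-sym : ∀ {v a b} → ReachAvoid G v a b → a ≢ v → ReachAvoid G v b a
  avoid-sym here         _   = here
  avoid-sym (step r e _) a≢v =
    avoid-trans (step here (sym G e) (avoid-end r a≢v)) (avoid-sym r a≢v)

  avoid-last-edge : ∀ {v a b} → ReachAvoid G v a b → a ≢ b →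
                    Σ (V G) λ p → ReachAvoid G v a p × Adj G p b
  avoid-last-edge here         a≢a = ⊥-elim (a≢a refl)
  avoid-last-edge (step r e _) _   = _ , r , e

  comp-self : ∀ {v x} → x ≢ v → InComp G v x x
  comp-self x≢v = x≢v , x≢v , here

  comp-step : ∀ {v x a b} → InComp G v x a → Adj G a b → b ≢ v → InComp G v x b
  comp-step (x≢v , _ , r) e b≢v = x≢v , b≢v , step r e b≢v

  comp-merge : ∀ {v x x′ a b} → InComp G v x a → InComp G v x′ a → InComp G v x′ b →
               InComp G v x b
  comp-merge (x≢v , _ , r₁) (x′≢v , _ , r₂) (_ , b≢v , r₃) =
    x≢v , b≢v , avoid-trans (avoid-trans r₁ (avoid-sym r₂ x′≢v)) r₃

  walk-into-comp : ∀ {v x ℓ a b} → Walk G ℓ a b → InComp G v x b →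
                   InComp G v x a ⊎ Σ ℕ λ ℓ′ → ℓ′ < ℓ × Walk G ℓ′ a v
  walk-into-comp nil b∈H = inj₁ b∈H
  walk-into-comp {v} (cons {x = a} e w) b∈H with walk-into-comp w b∈H
  ... | inj₂ (ℓ′ , ℓ′<ℓ , w′) = inj₂ (suc ℓ′ , s≤s ℓ′<ℓ , cons e w′)
  ... | inj₁ a′∈H with a ≟ v
  ...   | yes refl = inj₂ (0 , s≤s z≤n , nil)
  ...   | no a≢v   = inj₁ (comp-step a′∈H (sym G e) a≢v)

module Percolation (G : Graph) where

  initially-infected : ∀ {S : VPred G} {w} i → S w → Perc G S i w
  initially-infected zero    s = s
  initially-infected (suc i) s = inj₁ (initially-infected i s)

  percTime-transfer : ∀ {S S′ : VPred G} {v t} →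
                      (∀ i → Perc G S i v → Perc G S′ i v) → (∀ i → Perc G S′ i v → Perc G S i v) →
                      PercTime≡ G S v t → PercTime≡ G S′ v t
  percTime-transfer {t = t} to from (v∈Sₜ , not-before) =
    to t v∈Sₜ , λ s s<t v∈S′ₛ → not-before s s<t (from s v∈S′ₛ)

module Pendant (G : Graph) (u : V G) where
  open Connectivity G

  Reachable : V G → Set
  Reachable w = Σ ℕ λ ℓ → Walk G ℓ u w

  reachable-step : ∀ {a b} → Reachable a → Adj G a b → Reachable b
  reachable-step (ℓ , w) e = suc ℓ , snoc w e

  IsPendant : V G → V G → Set
  IsPendant v x = Separator G v × GoodComp G u v x

  InPendant : V G → Set
  InPendant w = Σ (V G) λ v → Σ (V G) λ x → IsPendant v x × InComp G v x w

  pendant-adj : ∀ {v x y} → IsPendant v x → InComp G v x y → Adj G v y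
  pendant-adj (_ , _ , _ , adj) = adj _

  pendant-avoids-u : ∀ {v x} → IsPendant v x → ¬ InComp G v x u
  pendant-avoids-u (_ , _ , u∉H , _) = u∉H

  u-not-pendant : ¬ InPendant u
  u-not-pendant (_ , _ , pend , u∈H) = pendant-avoids-u pend u∈H

  -- Every walk from u into a pendant component passes through its separator, to
  -- which all its vertices are adjacent; so they all lie at the same distance from u.
  far-uniform : ∀ {v x h h′} → IsPendant v x → InComp G v x h → N≥ G 3 u h →
                InComp G v x h′ → N≥ G 3 u h′
  far-uniform {h = h} pend h∈H h-far h′∈H ℓ ℓ<3 w with walk-into-comp w h′∈H
  ... | inj₁ u∈H = pendant-avoids-u pend u∈H
  ... | inj₂ (ℓ′ , ℓ′<ℓ , w′) =
    h-far (suc ℓ′) (≤-trans (s≤s ℓ′<ℓ) ℓ<3) (snoc w′ (pendant-adj pend h∈H))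

  -- Two pendant components cannot each contain the other's separator: a walk from
  -- u to one separator would have to pass through the other one earlier, and
  -- vice versa, giving an infinite descent of walk lengths.
  no-mutual-separators : ∀ {v x v₀ x₀} → IsPendant v x → IsPendant v₀ x₀ →
                         InComp G v₀ x₀ v → InComp G v x v₀ →
                         ∀ {ℓ} → Acc _<_ ℓ → ¬ Walk G ℓ u v
  no-mutual-separators pend pend₀ v∈H₀ v₀∈H (acc smaller) w with walk-into-comp w v∈H₀
  ... | inj₁ u∈H₀ = pendant-avoids-u pend₀ u∈H₀
  ... | inj₂ (ℓ′ , ℓ′<ℓ , w′) with walk-into-comp w′ v₀∈H
  ...   | inj₁ u∈H = pendant-avoids-u pend u∈H
  ...   | inj₂ (ℓ″ , ℓ″<ℓ′ , w″) =
    no-mutual-separators pend pend₀ v∈H₀ v₀∈H (smaller (<-trans ℓ″<ℓ′ ℓ′<ℓ)) w″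

  no-mutual-reachable : ∀ {v x v₀ x₀} → IsPendant v x → IsPendant v₀ x₀ →
                        InComp G v₀ x₀ v → InComp G v x v₀ → ¬ Reachable v
  no-mutual-reachable pend pend₀ v∈H₀ v₀∈H (ℓ , w) =
    no-mutual-separators pend pend₀ v∈H₀ v₀∈H (<-wellFounded ℓ) w

  -- Two pendant components meeting in a vertex have the same separator
  -- (if it is reachable): otherwise each separator lies in the other component.
  pendant-separator-unique : ∀ {v x v₀ x₀ h} → IsPendant v x → IsPendant v₀ x₀ →
                             InComp G v x h → InComp G v₀ x₀ h → Reachable v → v ≡ v₀
  pendant-separator-unique {v} {v₀ = v₀} pend pend₀ h∈H h∈H₀ r with v ≟ v₀
  ... | yes v≡v₀ = v≡v₀
  ... | no v≢v₀  = ⊥-elim (no-mutual-reachable pend pend₀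
          (comp-step h∈H₀ (sym G (pendant-adj pend h∈H)) v≢v₀)
          (comp-step h∈H (sym G (pendant-adj pend₀ h∈H₀)) (v≢v₀ ∘ ≡-sym)) r)

  pendant-comp-unique : ∀ {v x v₀ x₀ w m} → IsPendant v x → Reachable v → InComp G v x w →
                        IsPendant v₀ x₀ → InComp G v₀ x₀ w → InComp G v₀ x₀ m → InComp G v x m
  pendant-comp-unique pend r w∈H pend₀ w∈H₀ m∈H₀
    with pendant-separator-unique pend pend₀ w∈H w∈H₀ r
  ... | refl = comp-merge w∈H w∈H₀ m∈H₀

  separator-not-pendant : ∀ {v x v₀ x₀} → IsPendant v x → IsPendant v₀ x₀ →
                          InComp G v₀ x₀ v → Reachable v → ⊥
  separator-not-pendant {v} {x} {v₀} pend@(_ , x≢v , _) pend₀ v∈H₀ r with x ≟ v₀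
  ... | yes refl = no-mutual-reachable pend pend₀ v∈H₀ (comp-self x≢v) r
  ... | no x≢v₀ =
    let x∈H₀ = comp-step v∈H₀ (pendant-adj pend (comp-self x≢v)) x≢v₀
        (_ , v≢v₀ , _) = v∈H₀
    in v≢v₀ (pendant-separator-unique pend pend₀ (comp-self x≢v) x∈H₀ r)

  TwoIn : VPred G → V G → V G → Set
  TwoIn Q v x = Σ (V G) λ z₁ → Σ (V G) λ z₂ →
                z₁ ≢ z₂ × InComp G v x z₁ × InComp G v x z₂ × Q z₁ × Q z₂

module PendantInfection (G : Graph) (u : V G) where
  open Connectivity G
  open Percolation G
  open Pendant G u

  lift-two : ∀ {S : VPred G} {i v x} → TwoIn (Perc G S i) v x → TwoIn (Perc G S (suc i)) v x
  lift-two (z₁ , z₂ , z₁≢z₂ , h₁ , h₂ , p₁ , p₂) = z₁ , z₂ , z₁≢z₂ , h₁ , h₂ , inj₁ p₁ , inj₁ p₂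

  separator-infected : ∀ {S : VPred G} {i v x} → IsPendant v x →
                       TwoIn (Perc G S i) v x → Perc G S (suc i) v
  separator-infected pend (z₁ , z₂ , z₁≢z₂ , h₁ , h₂ , p₁ , p₂) =
    inj₂ (z₁ , z₂ , z₁≢z₂ , pendant-adj pend h₁ , pendant-adj pend h₂ , p₁ , p₂)

  -- An infected separator, together with an infected vertex y of a pendant
  -- component having some other vertex c, infects the neighbour of y on a path from c.
  separator-spreads : ∀ {S : VPred G} {i v x y c} → IsPendant v x → Perc G S i v →
                      InComp G v x y → Perc G S i y → InComp G v x c → c ≢ y →
                      TwoIn (Perc G S (suc i)) v x
  separator-spreads {v = v} {x} {y} pend v-inf y∈H@(_ , y≢v , x→y) y-inf (x≢v , c≢v , x→c) c≢y
    with avoid-last-edge (avoid-trans (avoid-sym x→c x≢v) x→y) c≢y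
  ... | d , c→d , d-y =
    y , d , (λ y≡d → irrefl G (subst (Adj G d) y≡d d-y)) , y∈H , d∈H , inj₁ y-inf ,
    inj₂ (v , y , (λ v≡y → y≢v (≡-sym v≡y)) , sym G (pendant-adj pend d∈H) , d-y , v-inf , y-inf)
    where
    d∈H : InComp G v x d
    d∈H = x≢v , avoid-end c→d c≢v , avoid-trans x→c c→d

module Simulation (G : Graph) (u : V G) (S₁ S₂ : VPred G)
  (outside  : ∀ w → S₁ w → S₂ w ⊎ Pendant.InPendant G u w)
  (inside   : ∀ {v x} → Pendant.IsPendant G u v x → Pendant.Reachable G u v →
              Pendant.TwoIn G u S₁ v x → Pendant.TwoIn G u S₂ v x)
  (occupied : ∀ {v x} → Pendant.IsPendant G u v x → Σ (V G) λ y → InComp G v x y × S₂ y)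
  where
  open Connectivity G
  open Percolation G
  open Pendant G u
  open PendantInfection G u

  OutsideInv : ℕ → Set
  OutsideInv i = ∀ w → Reachable w → Perc G S₁ i w → Perc G S₂ i w ⊎ InPendant w

  PendantInv : ℕ → Set
  PendantInv i = ∀ {v x} → IsPendant v x → Reachable v →
                 TwoIn (Perc G S₁ i) v x → TwoIn (Perc G S₂ i) v x

  StandsIn : V G → V G → V G → Set
  StandsIn w c w′ = c ≡ w′ ⊎ Σ (V G) λ x → IsPendant w x × InComp G w x w′ × InComp G w x c

  Proxy : ℕ → V G → V G → Set
  Proxy i w w′ = Σ (V G) λ c → Adj G w c × Perc G S₂ i c × StandsIn w c w′

  proxy : ∀ {i w w′} → Adj G w w′ → Perc G S₂ i w′ ⊎ InPendant w′ → InPendant w ⊎ Proxy i w w′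
  proxy {w′ = w′} e (inj₁ w′-inf) = inj₂ (w′ , e , w′-inf , inj₁ refl)
  proxy {i} {w} e (inj₂ (v , x , pend , w′∈H)) with w ≟ v
  ... | no w≢v = inj₁ (v , x , pend , comp-step w′∈H (sym G e) w≢v)
  ... | yes refl with occupied pend
  ...   | y , y∈H , y∈S₂ =
    inj₂ (y , pendant-adj pend y∈H , initially-infected {S₂} i y∈S₂ , inj₂ (x , pend , w′∈H , y∈H))

  shared-stand-in : ∀ {w c w₁ w₂} → w₁ ≢ w₂ → StandsIn w c w₁ → StandsIn w c w₂ →
                    Σ (V G) λ x → IsPendant w x × InComp G w x w₁ × InComp G w x w₂
  shared-stand-in w₁≢w₂ (inj₁ refl) (inj₁ refl) = ⊥-elim (w₁≢w₂ refl)
  shared-stand-in _ (inj₁ refl) (inj₂ (x , pend , w₂∈H , c∈H)) = x , pend , c∈H , w₂∈H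
  shared-stand-in _ (inj₂ (x , pend , w₁∈H , c∈H)) (inj₁ refl) = x , pend , w₁∈H , c∈H
  shared-stand-in _ (inj₂ (x , pend , w₁∈H , c∈H)) (inj₂ (_ , _ , w₂∈H′ , c∈H′)) =
    x , pend , w₁∈H , comp-merge c∈H c∈H′ w₂∈H′

  -- A newly infected reachable w has proxies for both infecting neighbours w₁, w₂
  -- (or is pendant); distinct proxies infect w, and a common one puts w₁, w₂ in a
  -- pendant component separated by w, which PendantInv then makes infect w.
  outside-step : ∀ i → OutsideInv i → PendantInv i → OutsideInv (suc i)
  outside-step i out pin w r (inj₁ w-inf) = map₁ inj₁ (out w r w-inf)
  outside-step i out pin w r (inj₂ (w₁ , w₂ , w₁≢w₂ , e₁ , e₂ , p₁ , p₂))
    with proxy {i} e₁ (out w₁ (reachable-step r e₁) p₁) | proxy {i} e₂ (out w₂ (reachable-step r e₂) p₂)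
  ... | inj₁ w-pend | _ = inj₂ w-pend
  ... | inj₂ _ | inj₁ w-pend = inj₂ w-pend
  ... | inj₂ (c₁ , f₁ , q₁ , s₁) | inj₂ (c₂ , f₂ , q₂ , s₂) with c₁ ≟ c₂
  ...   | no c₁≢c₂ = inj₁ (inj₂ (c₁ , c₂ , c₁≢c₂ , f₁ , f₂ , q₁ , q₂))
  ...   | yes refl with shared-stand-in w₁≢w₂ s₁ s₂
  ...     | x , pend , w₁∈H , w₂∈H =
    inj₁ (separator-infected {S₂} {i} pend (pin pend r (w₁ , w₂ , w₁≢w₂ , w₁∈H , w₂∈H , p₁ , p₂)))

  -- A newly infected vertex of a pendant component H was infected either from
  -- inside H (use PendantInv) or via the separator v (use OutsideInv for v).
  pendant-step : ∀ i → OutsideInv i → PendantInv i → PendantInv (suc i)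
  pendant-step i out pin {v} {x} pend r (w₁ , w₂ , w₁≢w₂ , h₁ , h₂ , p₁ , p₂) = by-cases p₁ p₂
    where
    -- v infected: it spreads into H from the S₂-vertex of H.
    from-separator : Perc G S₁ i v → TwoIn (Perc G S₂ (suc i)) v x
    from-separator v-inf with out v r v-inf
    ... | inj₂ (_ , _ , pend₀ , v∈H₀) = ⊥-elim (separator-not-pendant pend pend₀ v∈H₀ r)
    ... | inj₁ v-inf₂ with occupied pend
    ...   | y , y∈H , y∈S₂ with avoid-one w₁≢w₂ h₁ h₂ y
    ...     | c , c∈H , c≢y =
      separator-spreads {S₂} {i} pend v-inf₂ y∈H (initially-infected {S₂} i y∈S₂) c∈H c≢y

    -- z ∈ H newly infected by two neighbours, which lie in H unless one is v.
    newly : ∀ {z} → InComp G v x z →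
            (Σ (V G) λ a → Σ (V G) λ b → a ≢ b × Adj G z a × Adj G z b ×
               Perc G S₁ i a × Perc G S₁ i b) →
            TwoIn (Perc G S₂ (suc i)) v x
    newly z∈H (a , b , a≢b , ea , eb , pa , pb) with a ≟ v | b ≟ v
    ... | yes refl | _        = from-separator pa
    ... | no _     | yes refl = from-separator pb
    ... | no a≢v   | no b≢v   =
      lift-two {S₂} {i} (pin pend r (a , b , a≢b , comp-step z∈H ea a≢v , comp-step z∈H eb b≢v , pa , pb))

    by-cases : Perc G S₁ (suc i) w₁ → Perc G S₁ (suc i) w₂ → TwoIn (Perc G S₂ (suc i)) v x
    by-cases (inj₁ q₁) (inj₁ q₂) = lift-two {S₂} {i} (pin pend r (w₁ , w₂ , w₁≢w₂ , h₁ , h₂ , q₁ , q₂))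
    by-cases (inj₂ n₁) _         = newly h₁ n₁
    by-cases (inj₁ _)  (inj₂ n₂) = newly h₂ n₂

  invariants : ∀ i → OutsideInv i × PendantInv i
  invariants zero    = (λ w _ → outside w) , inside
  invariants (suc i) with invariants i
  ... | out , pin = outside-step i out pin , pendant-step i out pin

  -- u is reachable and in no pendant component.
  simulate : ∀ i → Perc G S₁ i u → Perc G S₂ i u
  simulate i u-inf with proj₁ (invariants i) u (0 , nil) u-inf
  ... | inj₁ u-inf₂ = u-inf₂
  ... | inj₂ u-pend = ⊥-elim (u-not-pendant u-pend)

module StartSets (G : Graph) (u : V G) where
  open Pendant G u

  Representative : Subset (n G) → V G → V G → V G → Set
  Representative T v x y = y ∈ T × InComp G v x y × (∀ z → z ∈ T → InComp G v x z → z ≡ y)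

  representative : ∀ {T v x} → InT0 G u T → IsPendant v x → Σ (V G) (Representative T v x)
  representative (reps , _) (sep , good) = reps _ _ sep good

  T0-pendant : ∀ {T w} → InT0 G u T → w ∈ T → InPendant w
  T0-pendant (_ , located) w∈T with located _ w∈T
  ... | v , x , sep , good , w∈H = v , x , (sep , good) , w∈H

  start-occupied : ∀ {T} → InT0 G u T → ∀ F {v x} → IsPendant v x →
                   Σ (V G) λ y → InComp G v x y × StartSet G u T F y
  start-occupied T∈𝒯 F pend with representative T∈𝒯 pend
  ... | y , y∈T , y∈H , _ = y , y∈H , inj₁ y∈T

  -- A pendant component meeting N≥3(u) lies inside it, so any two of its
  -- vertices are in T ∪ N≥3(u) ∪ F.
  far-pair : ∀ {T F v x w w₁ w₂} → IsPendant v x → InComp G v x w → N≥ G 3 u w →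
             w₁ ≢ w₂ → InComp G v x w₁ → InComp G v x w₂ → TwoIn (StartSet G u T F) v x
  far-pair pend w∈H w-far w₁≢w₂ h₁ h₂ =
    _ , _ , w₁≢w₂ , h₁ , h₂ , inj₂ (inj₁ (far-uniform pend w∈H w-far h₁)) ,
    inj₂ (inj₁ (far-uniform pend w∈H w-far h₂))

module Exchange (G : Graph) (u : V G) (T₀ T₀′ : Subset (n G))
  (T₀∈𝒯 : InT0 G u T₀) (T₀′∈𝒯 : InT0 G u T₀′) (F : Subset (n G)) where
  open Pendant G u
  open StartSets G u

  Mate : V G → V G → Set
  Mate z m = Σ (V G) λ v → Σ (V G) λ x → IsPendant v x × InComp G v x z × Representative T₀ v x m

  mate : ∀ {z} → z ∈ T₀′ → Σ (V G) (Mate z)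
  mate z∈T₀′ with T0-pendant T₀′∈𝒯 z∈T₀′
  ... | v , x , pend , z∈H with representative T₀∈𝒯 pend
  ...   | m , m-rep = m , v , x , pend , z∈H , m-rep

  exchange : V G → Maybe (V G)
  exchange z with z ∈? T₀′ | z ∈? T₀
  ... | yes z∈T₀′ | _     = just (proj₁ (mate z∈T₀′))
  ... | no _      | yes _ = nothing
  ... | no _      | no _  = just z

  exchange-keeps : ∀ z → z ∉ T₀′ → z ∉ T₀ → exchange z ≡ just z
  exchange-keeps z z∉T₀′ z∉T₀ with z ∈? T₀′ | z ∈? T₀
  ... | yes z∈T₀′ | _      = ⊥-elim (z∉T₀′ z∈T₀′)
  ... | no _      | yes z∈T₀ = ⊥-elim (z∉T₀ z∈T₀)
  ... | no _      | no _   = refl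

  exchange-mate : ∀ z → z ∈ T₀′ → Σ (V G) λ m → exchange z ≡ just m × Mate z m
  exchange-mate z z∈T₀′ with z ∈? T₀′
  ... | yes is-in = proj₁ (mate is-in) , refl , proj₂ (mate is-in)
  ... | no z∉T₀′  = ⊥-elim (z∉T₀′ z∈T₀′)

  exchange-source : ∀ {z w} → exchange z ≡ just w → (z ≡ w × z ∉ T₀) ⊎ (z ∈ T₀′ × Mate z w)
  exchange-source {z} ex with z ∈? T₀′ | z ∈? T₀
  exchange-source refl | yes z∈T₀′ | _     = inj₂ (z∈T₀′ , proj₂ (mate z∈T₀′))
  exchange-source ()   | no _      | yes _
  exchange-source refl | no _      | no z∉T₀ = inj₁ (refl , z∉T₀)

  F′ : Subset (n G)
  F′ = image exchange F

  ∈F′⁻ : ∀ {w} → w ∈ F′ → (w ∈ F × w ∉ T₀) ⊎ Σ (V G) λ z → z ∈ F × z ∈ T₀′ × Mate z w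
  ∈F′⁻ w∈F′ with ∈-image⁻ exchange F w∈F′
  ... | z , z∈F , ex with exchange-source ex
  ...   | inj₁ (refl , z∉T₀)   = inj₁ (z∈F , z∉T₀)
  ...   | inj₂ (z∈T₀′ , z-mate) = inj₂ (z , z∈F , z∈T₀′ , z-mate)

  S S′ : VPred G
  S  = StartSet G u T₀ F
  S′ = StartSet G u T₀′ F′

  forward-outside : ∀ w → S w → S′ w ⊎ InPendant w
  forward-outside w (inj₁ w∈T₀)        = inj₂ (T0-pendant T₀∈𝒯 w∈T₀)
  forward-outside w (inj₂ (inj₁ w-far)) = inj₁ (inj₂ (inj₁ w-far))
  forward-outside w (inj₂ (inj₂ w∈F)) with w ∈? T₀′ | w ∈? T₀
  ... | yes w∈T₀′ | _        = inj₂ (T0-pendant T₀′∈𝒯 w∈T₀′)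
  ... | no _      | yes w∈T₀ = inj₂ (T0-pendant T₀∈𝒯 w∈T₀)
  ... | no w∉T₀′  | no w∉T₀  =
    inj₁ (inj₂ (inj₂ (∈-image⁺ exchange F w w∈F (exchange-keeps w w∉T₀′ w∉T₀))))

  -- Two S-vertices of H: one of them, w, is not the T₀-representative y, so it is
  -- far (then all of H is), or in F; then w itself (if w ∉ T₀′) or the mate y of
  -- w = y′ (if w ∈ T₀′) lies in F′, and pairs with y′.
  forward-inside : ∀ {v x} → IsPendant v x → Reachable v → TwoIn S v x → TwoIn S′ v x
  forward-inside {v} {x} pend r (w₁ , w₂ , w₁≢w₂ , h₁ , h₂ , s₁ , s₂)
    with representative T₀∈𝒯 pend | representative T₀′∈𝒯 pend
  ... | y , y∈T₀ , y∈H , y-unique | y′ , y′∈T₀′ , y′∈H , y′-unique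
    with avoid-one {P = λ c → InComp G v x c × S c} w₁≢w₂ (h₁ , s₁) (h₂ , s₂) y
  ... | w , (w∈H , w∈S) , w≢y = one w∈S
    where
    w∉T₀ : w ∉ T₀
    w∉T₀ w∈T₀ = w≢y (y-unique w w∈T₀ w∈H)

    one : S w → TwoIn S′ v x
    one (inj₁ w∈T₀)        = ⊥-elim (w∉T₀ w∈T₀)
    one (inj₂ (inj₁ w-far)) = far-pair pend w∈H w-far w₁≢w₂ h₁ h₂
    one (inj₂ (inj₂ w∈F)) with w ∈? T₀′
    ... | no w∉T₀′ =
      w , y′ , (λ w≡y′ → w∉T₀′ (subst (_∈ T₀′) (≡-sym w≡y′) y′∈T₀′)) , w∈H , y′∈H ,
      inj₂ (inj₂ (∈-image⁺ exchange F w w∈F (exchange-keeps w w∉T₀′ w∉T₀))) ,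
      inj₁ y′∈T₀′
    ... | yes w∈T₀′ with exchange-mate w w∈T₀′
    ...   | m , ex , (v₀ , x₀ , pend₀ , w∈H₀ , m∈T₀ , m∈H₀ , _) =
      y , y′ , y≢y′ , y∈H , y′∈H , inj₂ (inj₂ y∈F′) , inj₁ y′∈T₀′
      where
      y∈F′ : y ∈ F′
      y∈F′ = subst (_∈ F′) (y-unique m m∈T₀ (pendant-comp-unique pend r w∈H pend₀ w∈H₀ m∈H₀))
                   (∈-image⁺ exchange F w w∈F ex)
      y≢y′ : y ≢ y′
      y≢y′ y≡y′ = w≢y (trans (y′-unique w w∈T₀′ w∈H) (≡-sym y≡y′))

  backward-outside : ∀ w → S′ w → S w ⊎ InPendant w
  backward-outside w (inj₁ w∈T₀′)        = inj₂ (T0-pendant T₀′∈𝒯 w∈T₀′)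
  backward-outside w (inj₂ (inj₁ w-far)) = inj₁ (inj₂ (inj₁ w-far))
  backward-outside w (inj₂ (inj₂ w∈F′)) with ∈F′⁻ w∈F′
  ... | inj₁ (w∈F , _) = inj₁ (inj₂ (inj₂ w∈F))
  ... | inj₂ (_ , _ , _ , v , x , pend , _ , _ , w∈H , _) = inj₂ (v , x , pend , w∈H)

  -- Two S′-vertices of H: one of them, w, is not the T₀′-representative y′, so it
  -- is far, or in F′; then w ∈ F \ T₀ pairs with y, or w = y is the mate of
  -- some z = y′ ∈ F.
  backward-inside : ∀ {v x} → IsPendant v x → Reachable v → TwoIn S′ v x → TwoIn S v x
  backward-inside {v} {x} pend r (w₁ , w₂ , w₁≢w₂ , h₁ , h₂ , s₁ , s₂)
    with representative T₀∈𝒯 pend | representative T₀′∈𝒯 pend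
  ... | y , y∈T₀ , y∈H , y-unique | y′ , y′∈T₀′ , y′∈H , y′-unique
    with avoid-one {P = λ c → InComp G v x c × S′ c} w₁≢w₂ (h₁ , s₁) (h₂ , s₂) y′
  ... | w , (w∈H , w∈S′) , w≢y′ = one w∈S′
    where
    one : S′ w → TwoIn S v x
    one (inj₁ w∈T₀′)        = ⊥-elim (w≢y′ (y′-unique w w∈T₀′ w∈H))
    one (inj₂ (inj₁ w-far)) = far-pair pend w∈H w-far w₁≢w₂ h₁ h₂
    one (inj₂ (inj₂ w∈F′)) with ∈F′⁻ w∈F′
    ... | inj₁ (w∈F , w∉T₀) =
      w , y , (λ w≡y → w∉T₀ (subst (_∈ T₀) (≡-sym w≡y) y∈T₀)) , w∈H , y∈H ,
      inj₂ (inj₂ w∈F) , inj₁ y∈T₀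
    ... | inj₂ (z , z∈F , z∈T₀′ , v₀ , x₀ , pend₀ , z∈H₀ , w∈T₀ , w∈H₀ , _) =
      y , z , y≢z , y∈H , z∈H , inj₁ y∈T₀ , inj₂ (inj₂ z∈F)
      where
      z∈H : InComp G v x z
      z∈H = pendant-comp-unique pend r w∈H pend₀ w∈H₀ z∈H₀
      y≢z : y ≢ z
      y≢z y≡z = w≢y′ (trans (y-unique w w∈T₀ w∈H) (trans y≡z (y′-unique z z∈T₀′ z∈H)))

  forward : ∀ i → Perc G S i u → Perc G S′ i u
  forward = Simulation.simulate G u S S′ forward-outside forward-inside (start-occupied T₀′∈𝒯 F′)

  backward : ∀ i → Perc G S′ i u → Perc G S i u
  backward = Simulation.simulate G u S′ S backward-outside backward-inside (start-occupied T₀∈𝒯 F)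

lemma8 : (G : Graph) (u : V G) →
    (Σ (Subset (n G)) λ T₀ → InT0 G u T₀ × Good G u T₀) →
    (T₀′ : Subset (n G)) → InT0 G u T₀′ → Good G u T₀′
lemma8 G u (T₀ , T₀∈𝒯 , F , ∣F∣≤4 , u-at-3) T₀′ T₀′∈𝒯 =
  F′ , ≤-trans (∣image∣≤ exchange F) ∣F∣≤4 , percTime-transfer forward backward u-at-3
  where
  open Percolation G
  open Exchange G u T₀ T₀′ T₀∈𝒯 T₀′∈𝒯 F
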